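{- Let $\mathcal F$ be a finite set of connected edge-colored graphs with colors in $[r]$ such that for every color $i\in[r]$ there exists an $\mathcal F$-safe colored $i$-determiner. Then for every $d\in\mathbb N$ and every $i\in[r]$ there exists an $\mathcal F$-safe $d$-remote colored $i$-determiner.
   Context: All graphs are finite, simple, undirected. An edge-colored graph is $(G,\gamma)$ with $\gamma:E(G)\to[r]$; it is $\mathcal F$-free if no $(F,\varphi)\in\mathcal F$ admits a graph homomorphism $h:F\to G$ with $\gamma(h(e))=\varphi(e)$ for all edges $e$ of $F$. A partially edge-colored graph is $(G,\xi)$ with $\xi:S\to[r]$, $S=\mathrm{dom}(\xi)\subseteq E(G)$; an extension of $\xi$ is any $\gamma:E(G)\to[r]$ with $\gamma|_S=\xi$. Gluing: given graphs $G,H$ with pairwise disjoint edges $e_1,\dots,e_k\in E(G)$ and pairwise disjoint edges $f_1,\dots,f_k\in E(H)$, $G\oplus H$ is obtained from the disjoint union by identifying $e_j$ with $f_j$ for each $j$ (identifying endpoints in either of the two ways). $(G,\xi)$ is $\mathcal F$-safe along pairwise disjoint uncolored edges $e_1,\dots,e_k$ if (a) $\xi$ has an $\mathcal F$-free extension, and (b) for every $\mathcal F$-free $(H,\gamma_H)$ and pairwise disjoint $f_1,\dots,f_k\in E(H)$ such that some $\mathcal F$-free extension $\gamma$ of $\xi$ satisfies $\gamma_H(f_j)=\gamma(e_j)$ for all $j$, the partial coloring $\xi\cup\gamma_H$ of $G\oplus H$ has an $\mathcal F$-free extension. The distance between edges $e,e'$ is the minimum graph distance between an endpoint of $e$ and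 an endpoint of $e'$; $\mathrm{dist}(e,S)=\min_{e'\in S}\mathrm{dist}(e,e')$. A colored $i$-determiner is a triple $(G,\xi,e)$ with $e\in E(G)\setminus\mathrm{dom}(\xi)$ such that (1) one endpoint of $e$ is not incident to any edge of $\mathrm{dom}(\xi)$, (2) $\xi$ has an $\mathcal F$-free extension, (3) every $\mathcal F$-free extension $\gamma$ of $\xi$ satisfies $\gamma(e)=i$. It is $d$-remote if $\mathrm{dist}(e,\mathrm{dom}(\xi))\geq d$, and $\mathcal F$-safe if $(G,\xi)$ is $\mathcal F$-safe along $e$. -}

module Defs where

open import Data.Nat using (ℕ; _≤_)
open import Data.Fin using (Fin)
open import Data.Bool using (Bool; true; false; T)
open import Data.Maybe using (Maybe; just; nothing)
open import Data.List using (List)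
open import Data.List.Membership.Propositional using (_∈_)
open import Data.Product using (Σ; ∃; _×_; _,_; proj₁; proj₂)
open import Data.Sum using (_⊎_)
open import Relation.Binary.PropositionalEquality using (_≡_; _≢_)
open import Relation.Nullary using (¬_)

record Graph : Set where
  field
    n      : ℕ
    adj    : Fin n → Fin n → Bool
    sym    : ∀ u v → adj u v ≡ adj v u
    irrefl : ∀ u → adj u u ≡ false

open Graph public

V : Graph → Set
V G = Fin (n G)

Adj : (G : Graph) → V G → V G → Set
Adj G u v = T (adj G u v)

-- An edge, given by an (arbitrarily) oriented pair of adjacent vertices.
record Edge (G : Graph) : Set where
  constructor edge
  field
    src : V G
    tgt : V G
    isAdj : Adj G src tgt

open Edge public

Endpoint : {G : Graph} → V G → Edge G → Set
Endpoint w e = (w ≡ src e) ⊎ (w ≡ tgt e)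

-- Walks of a given length (graph distance = minimum walk length)
data Walk (G : Graph) : V G → V G → ℕ → Set where
  here : ∀ {u} → Walk G u u 0
  step : ∀ {u v w ℓ} → Adj G u v → Walk G v w ℓ → Walk G u w (Data.Nat.suc ℓ)

Connected : Graph → Set
Connected G = ∀ u v → ∃ λ ℓ → Walk G u v ℓ

-- Edge colourings with colours in [r] = Fin r.
-- A colouring is a function on ordered pairs, symmetric on edges; only
-- its values on edges are relevant.

record Coloring (r : ℕ) (G : Graph) : Set where
  field
    col : V G → V G → Fin r
    col-sym : ∀ u v → Adj G u v → col u v ≡ col v u

open Coloring public

_⟦_⟧ : ∀ {r G} → Coloring r G → Edge G → Fin r
γ ⟦ e ⟧ = col γ (src e) (tgt e)

record PColoring (r : ℕ) (G : Graph) : Set where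
  field
    pcol : V G → V G → Maybe (Fin r)
    pcol-sym : ∀ u v → Adj G u v → pcol u v ≡ pcol v u

open PColoring public

Uncolored : ∀ {r G} → PColoring r G → Edge G → Set
Uncolored ξ e = pcol ξ (src e) (tgt e) ≡ nothing

Extends : ∀ {r G} → PColoring r G → Coloring r G → Set
Extends {G = G} ξ γ =
  ∀ u v → Adj G u v → ∀ c → pcol ξ u v ≡ just c → col γ u v ≡ c

record ColoredGraph (r : ℕ) : Set where
  constructor _,ᶜ_
  field
    graph : Graph
    coloring : Coloring r graph

open ColoredGraph public

ColHom : ∀ {r} → ColoredGraph r → (G : Graph) → Coloring r G → Set
ColHom (F ,ᶜ φ) G γ =
  Σ (V F → V G) λ h →
    ∀ u v → Adj F u v → Adj G (h u) (h v) × (col γ (h u) (h v) ≡ col φ u v)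

Family : ℕ → Set
Family r = List (ColoredGraph r)

Free : ∀ {r} → Family r → (G : Graph) → Coloring r G → Set
Free 𝓕 G γ = ∀ {F} → F ∈ 𝓕 → ¬ ColHom F G γ

FreeExt : ∀ {r} → Family r → {G : Graph} → PColoring r G → Coloring r G → Set
FreeExt 𝓕 {G} ξ γ = Extends ξ γ × Free 𝓕 G γ

PairwiseDisjoint : ∀ {G k} → (Fin k → Edge G) → Set
PairwiseDisjoint {G} {k} e =
  ∀ j j' → j ≢ j' → ∀ (w : V G) → Endpoint w (e j) → ¬ Endpoint w (e j')

-- K, together with iG : V G → V K and iH : V H → V K, is (an isomorphic
-- copy of) a gluing G ⊕ H along e_j ~ f_j (with any choice of orientation
-- for each j): the disjoint union of G and H with the endpoints of e_j
-- identified with those of f_j, as a simple graph.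
record IsGluing (G H : Graph) {k : ℕ} (e : Fin k → Edge G) (f : Fin k → Edge H)
                (K : Graph) (iG : V G → V K) (iH : V H → V K) : Set where
  field
    iG-inj : ∀ x x' → iG x ≡ iG x' → x ≡ x'
    iH-inj : ∀ y y' → iH y ≡ iH y' → y ≡ y'
    cover  : ∀ z → (∃ λ x → iG x ≡ z) ⊎ (∃ λ y → iH y ≡ z)
    glue   : ∀ j →
      ((iG (src (e j)) ≡ iH (src (f j))) × (iG (tgt (e j)) ≡ iH (tgt (f j))))
      ⊎ ((iG (src (e j)) ≡ iH (tgt (f j))) × (iG (tgt (e j)) ≡ iH (src (f j))))
    only-glue : ∀ x y → iG x ≡ iH y → ∃ λ j → Endpoint x (e j)
    edges-G : ∀ x x' → Adj G x x' → Adj K (iG x) (iG x')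
    edges-H : ∀ y y' → Adj H y y' → Adj K (iH y) (iH y')
    edges-K : ∀ z z' → Adj K z z' →
      (∃ λ x → ∃ λ x' → iG x ≡ z × iG x' ≡ z' × Adj G x x')
      ⊎ (∃ λ y → ∃ λ y' → iH y ≡ z × iH y' ≡ z' × Adj H y y')

record Safe {r : ℕ} (𝓕 : Family r) (G : Graph) (ξ : PColoring r G)
            {k : ℕ} (e : Fin k → Edge G) : Set₁ where
  field
    -- the e_j are pairwise disjoint and uncoloured (standing hypotheses)
    disjoint  : PairwiseDisjoint e
    uncolored : ∀ j → Uncolored ξ (e j)
    has-free-ext : ∃ λ γ → FreeExt 𝓕 ξ γ
    glue-ext : ∀ (H : Graph) (γH : Coloring r H) → Free 𝓕 H γH →
      ∀ (f : Fin k → Edge H) → PairwiseDisjoint f →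
      (∃ λ γ → FreeExt 𝓕 ξ γ × (∀ j → γH ⟦ f j ⟧ ≡ γ ⟦ e j ⟧)) →
      ∀ (K : Graph) (iG : V G → V K) (iH : V H → V K) →
      IsGluing G H e f K iG iH →
      -- the partial colouring ξ ∪ γH of K has an 𝓕-free extension
      ∃ λ (γK : Coloring r K) →
        (∀ x x' → Adj G x x' → ∀ c → pcol ξ x x' ≡ just c →
           col γK (iG x) (iG x') ≡ c)
        × (∀ y y' → Adj H y y' → col γK (iH y) (iH y') ≡ col γH y y')
        × Free 𝓕 K γK

record IsDeterminer {r : ℕ} (𝓕 : Family r) (i : Fin r)
                    (G : Graph) (ξ : PColoring r G) (e : Edge G) : Set where
  field
    e-uncolored : Uncolored ξ e
    free-endpoint : ∃ λ w → Endpoint w e × (∀ z → Adj G w z → pcol ξ w z ≡ nothing)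
    has-free-ext : ∃ λ γ → FreeExt 𝓕 ξ γ
    forced : ∀ γ → FreeExt 𝓕 ξ γ → γ ⟦ e ⟧ ≡ i

-- dist(e, dom ξ) ≥ d
Remote : ∀ {r} (d : ℕ) (G : Graph) (ξ : PColoring r G) (e : Edge G) → Set
Remote {r} d G ξ e =
  ∀ w → Endpoint w e → ∀ x x' → Adj G x x' → ∀ (c : Fin r) → pcol ξ x x' ≡ just c →
    ∀ (z : V G) → (z ≡ x ⊎ z ≡ x') → ∀ ℓ → Walk G w z ℓ → d ≤ ℓ

single : ∀ {G : Graph} → Edge G → Fin 1 → Edge G
single e _ = e

SafeDeterminer : ∀ {r} → Family r → Fin r → Set₁
SafeDeterminer {r} 𝓕 i =
  Σ Graph λ G → Σ (PColoring r G) λ ξ → Σ (Edge G) λ e →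
    IsDeterminer 𝓕 i G ξ e × Safe 𝓕 G ξ (single e)

SafeRemoteDeterminer : ∀ {r} → Family r → ℕ → Fin r → Set₁
SafeRemoteDeterminer {r} 𝓕 d i =
  Σ Graph λ G → Σ (PColoring r G) λ ξ → Σ (Edge G) λ e →
    IsDeterminer 𝓕 i G ξ e × Remote d G ξ e × Safe 𝓕 G ξ (single e)

{-# OPTIONS --safe #-}
-- Let (G, ξ, e) be a safe i-determiner and g an edge of G of colour c. Gluing a safe c-determiner
-- (D, ξD, eD) onto G, identifying eD with g and letting ξD override the colour of g, gives again a
-- safe i-determiner: in every 𝓕-free extension D forces colour c on g, so the extension restricts
-- to an 𝓕-free extension of ξ and e is still forced to i; and a graph H glued along e is handled by
-- regrouping (D ⊕ G) ⊕ H as D ⊕ (G ⊕ H), using first the safety of G and then that of D.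
-- Doing this on every coloured edge replaces ξ by copies of the colourings of the D's. If the free
-- endpoint of eD is always put on the end of g that may lie on e, afterwards no coloured edge
-- touches e. Repeating the process with d-remote determiners then gives a (d+1)-remote one, since
-- a walk from e into a copy of D starts inside G and enters D through an end of eD.
module Submission where

open import Defs hiding (sym)
open import Data.Nat using (ℕ; zero; suc; _+_; _≤_; z≤n; s≤s)
open import Data.Nat.Properties using (≤-trans; m≤n⇒m≤1+n)
open import Data.Fin using (Fin; zero; suc; _↑ˡ_; _↑ʳ_; splitAt)
open import Data.Fin.Properties
  using (_≟_; any?; suc-injective; ↑ˡ-injective; ↑ʳ-injective; splitAt-↑ˡ; splitAt-↑ʳ)
open import Data.Bool using (T; false)
open import Data.Bool.Properties using (T?)
open import Data.Maybe using (Maybe; just; nothing)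
open import Data.Maybe.Properties using (just-injective)
open import Data.List using (List; []; _∷_; cartesianProduct; allFin)
open import Data.List.Membership.Propositional using (_∈_)
open import Data.List.Membership.Propositional.Properties using (∈-cartesianProduct⁺; ∈-allFin)
open import Data.List.Relation.Unary.Any using (here; there)
open import Data.List.Relation.Unary.All using (All)
open import Data.Product as Product using (∃; _×_; _,_; proj₁; proj₂)
open import Data.Sum as Sum using (_⊎_; inj₁; inj₂; [_,_]′)
open import Relation.Binary.PropositionalEquality
open import Relation.Nullary using (¬_; Dec; yes; no; contradiction)
open import Relation.Nullary.Decidable using (_⊎-dec_; _×-dec_; ⌊_⌋; toWitness; fromWitness)

Adj-sym : (G : Graph) {u v : V G} → Adj G u v → Adj G v u
Adj-sym G {u} {v} = subst T (Graph.sym G u v)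

Adj⇒≢ : (G : Graph) {u v : V G} → Adj G u v → u ≢ v
Adj⇒≢ G {u} adj refl = subst T (Graph.irrefl G u) adj

src≢tgt : {G : Graph} (e : Edge G) → src e ≢ tgt e
src≢tgt {G} e = Adj⇒≢ G (isAdj e)

pcol-flip : ∀ {r G} (ξ : PColoring r G) {u v : V G} → Adj G u v → pcol ξ v u ≡ pcol ξ u v
pcol-flip {G = G} ξ a = pcol-sym ξ _ _ (Adj-sym G a)

Ends : {G : Graph} → Edge G → V G → V G → Set
Ends e p q = (p ≡ src e × q ≡ tgt e) ⊎ (p ≡ tgt e × q ≡ src e)

Endpoints-adjacent : (G : Graph) (e : Edge G) {p q : V G} →
  Endpoint p e → Endpoint q e → p ≡ q ⊎ Adj G p q
Endpoints-adjacent G e (inj₁ refl) (inj₁ refl) = inj₁ refl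
Endpoints-adjacent G e (inj₁ refl) (inj₂ refl) = inj₂ (isAdj e)
Endpoints-adjacent G e (inj₂ refl) (inj₁ refl) = inj₂ (Adj-sym G (isAdj e))
Endpoints-adjacent G e (inj₂ refl) (inj₂ refl) = inj₁ refl

≢just⇒≡nothing : ∀ {A : Set} {m : Maybe A} → (∀ a → m ≢ just a) → m ≡ nothing
≢just⇒≡nothing {m = nothing} _ = refl
≢just⇒≡nothing {m = just a} m≢just = contradiction refl (m≢just a)

single-disjoint : ∀ {G : Graph} (e : Edge G) → PairwiseDisjoint (single e)
single-disjoint e zero zero 0≢0 = contradiction refl 0≢0

Hom : (G H : Graph) → (V G → V H) → Set
Hom G H h = ∀ u v → Adj G u v → Adj H (h u) (h v)

WeakHom : (G H : Graph) → (V G → V H) → Set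
WeakHom G H h = ∀ u v → Adj G u v → h u ≡ h v ⊎ Adj H (h u) (h v)

WeakHom-Walk : ∀ {G H h} → WeakHom G H h → ∀ {u v ℓ} → Walk G u v ℓ →
  ∃ λ ℓ′ → ℓ′ ≤ ℓ × Walk H (h u) (h v) ℓ′
WeakHom-Walk hom here = 0 , z≤n , here
WeakHom-Walk {H = H} {h} hom (step {u} {v} {w} a walk) with WeakHom-Walk hom walk | hom u v a
... | ℓ′ , ℓ′≤ℓ , walk′ | inj₁ hu≡hv =
  ℓ′ , m≤n⇒m≤1+n ℓ′≤ℓ , subst (λ x → Walk H x (h w) ℓ′) (sym hu≡hv) walk′
... | ℓ′ , ℓ′≤ℓ , walk′ | inj₂ a′ = suc ℓ′ , s≤s ℓ′≤ℓ , step a′ walk′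

pullback : ∀ {r} (G : Graph) {H : Graph} (h : V G → V H) → Hom G H h → Coloring r H → Coloring r G
pullback G h hom γ = record
  { col = λ u v → col γ (h u) (h v)
  ; col-sym = λ u v a → col-sym γ (h u) (h v) (hom u v a) }

Free-pullback : ∀ {r} {𝓕 : Family r} (G : Graph) {H : Graph} (h : V G → V H) (hom : Hom G H h)
  (γ : Coloring r H) → Free 𝓕 H γ → Free 𝓕 G (pullback G h hom γ)
Free-pullback G h hom γ free F∈𝓕 (φ , φ-hom) =
  free F∈𝓕 ((λ x → h (φ x)) , λ u v a → hom _ _ (proj₁ (φ-hom u v a)) , proj₂ (φ-hom u v a))

-- Induced subgraphs and gluing along one edge

record Enumeration {n : ℕ} (P : Fin n → Set) : Set where
  field
    size : ℕ
    embed : Fin size → Fin n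
    embed-injective : ∀ a b → embed a ≡ embed b → a ≡ b
    embed-sound : ∀ a → P (embed a)
    embed-complete : ∀ z → P z → ∃ λ a → embed a ≡ z

enumerate : ∀ {n} {P : Fin n → Set} → (∀ z → Dec (P z)) → Enumeration P
enumerate {zero} P? = record
  { size = 0 ; embed = λ () ; embed-injective = λ () ; embed-sound = λ () ; embed-complete = λ () }
enumerate {suc n} P? with P? zero | enumerate (λ z → P? (suc z))
... | no ¬P0 | E = record
  { size = size
  ; embed = λ a → suc (embed a)
  ; embed-injective = λ a b eq → embed-injective a b (suc-injective eq)
  ; embed-sound = embed-sound
  ; embed-complete = λ { zero P0 → contradiction P0 ¬P0
                       ; (suc z) Pz → proj₁ (embed-complete z Pz) , cong suc (proj₂ (embed-complete z Pz)) } }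
  where open Enumeration E
... | yes P0 | E = record
  { size = suc size
  ; embed = λ { zero → zero ; (suc a) → suc (embed a) }
  ; embed-injective = λ { zero zero _ → refl
                        ; zero (suc _) ()
                        ; (suc _) zero ()
                        ; (suc a) (suc b) eq → cong suc (embed-injective a b (suc-injective eq)) }
  ; embed-sound = λ { zero → P0 ; (suc a) → embed-sound a }
  ; embed-complete = λ { zero _ → zero , refl
                       ; (suc z) Pz → suc (proj₁ (embed-complete z Pz)) , cong suc (proj₂ (embed-complete z Pz)) } }
  where open Enumeration E

Induced : (K : Graph) {P : V K → Set} → Enumeration P → Graph
Induced K E = record
  { n = size
  ; adj = λ a b → adj K (embed a) (embed b)
  ; sym = λ a b → Graph.sym K (embed a) (embed b)
  ; irrefl = λ a → Graph.irrefl K (embed a) }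
  where open Enumeration E

Image : {A : Set} {m : ℕ} → (Fin m → A) → A → Set
Image h z = ∃ λ x → h x ≡ z

image? : ∀ {m k} (h : Fin m → Fin k) (z : Fin k) → Dec (Image h z)
image? h z = any? (λ x → h x ≟ z)

module JointImage (U : Graph) {G H : Graph} (a : V G → V U) (b : V H → V U) where

  InImage : V U → Set
  InImage z = Image a z ⊎ Image b z

  inImage? : ∀ z → Dec (InImage z)
  inImage? z = image? a z ⊎-dec image? b z

  enumeration : Enumeration InImage
  enumeration = enumerate inImage?

  open Enumeration enumeration public using (embed; embed-injective; embed-sound; embed-complete)

  S : Graph
  S = Induced U enumeration

  a′ : V G → V S
  a′ x = proj₁ (embed-complete (a x) (inj₁ (x , refl)))

  embed-a′ : ∀ x → embed (a′ x) ≡ a x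
  embed-a′ x = proj₂ (embed-complete (a x) (inj₁ (x , refl)))

  b′ : V H → V S
  b′ y = proj₁ (embed-complete (b y) (inj₂ (y , refl)))

  embed-b′ : ∀ y → embed (b′ y) ≡ b y
  embed-b′ y = proj₂ (embed-complete (b y) (inj₂ (y , refl)))

  a′-unique : ∀ {x s} → a x ≡ embed s → a′ x ≡ s
  a′-unique {x} eq = embed-injective _ _ (trans (embed-a′ x) eq)

  b′-unique : ∀ {y s} → b y ≡ embed s → b′ y ≡ s
  b′-unique {y} eq = embed-injective _ _ (trans (embed-b′ y) eq)

  cover : ∀ s → Image a′ s ⊎ Image b′ s
  cover s with embed-sound s
  ... | inj₁ (x , ax≡s) = inj₁ (x , a′-unique ax≡s)
  ... | inj₂ (y , by≡s) = inj₂ (y , b′-unique by≡s)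

  isGluing : ∀ {j} {e : Fin j → Edge G} {f : Fin j → Edge H} →
    (∀ x x′ → a x ≡ a x′ → x ≡ x′) →
    (∀ y y′ → b y ≡ b y′ → y ≡ y′) →
    (∀ i → ((a (src (e i)) ≡ b (src (f i))) × (a (tgt (e i)) ≡ b (tgt (f i))))
         ⊎ ((a (src (e i)) ≡ b (tgt (f i))) × (a (tgt (e i)) ≡ b (src (f i))))) →
    (∀ x y → a x ≡ b y → ∃ λ i → Endpoint x (e i)) →
    Hom G U a → Hom H U b →
    (∀ z z′ → InImage z → InImage z′ → Adj U z z′ →
        (∃ λ x → ∃ λ x′ → a x ≡ z × a x′ ≡ z′ × Adj G x x′)
      ⊎ (∃ λ y → ∃ λ y′ → b y ≡ z × b y′ ≡ z′ × Adj H y y′)) →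
    IsGluing G H e f S a′ b′
  isGluing a-inj b-inj glue only-glue a-hom b-hom edges = record
    { iG-inj = λ x x′ eq → a-inj x x′ (a′≡a′ eq)
    ; iH-inj = λ y y′ eq → b-inj y y′ (b′≡b′ eq)
    ; cover = cover
    ; glue = λ i → Sum.map (Product.map b′-from-b b′-from-b) (Product.map b′-from-b b′-from-b) (glue i)
    ; only-glue = λ x y eq → only-glue x y (trans (sym (embed-a′ x)) (trans (cong embed eq) (embed-b′ y)))
    ; edges-G = λ x x′ adj → subst₂ (Adj U) (sym (embed-a′ x)) (sym (embed-a′ x′)) (a-hom x x′ adj)
    ; edges-H = λ y y′ adj → subst₂ (Adj U) (sym (embed-b′ y)) (sym (embed-b′ y′)) (b-hom y y′ adj)
    ; edges-K = λ s s′ adj → Sum.map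
        (λ (x , x′ , ax , ax′ , adjG) → x , x′ , a′-unique ax , a′-unique ax′ , adjG)
        (λ (y , y′ , by , by′ , adjH) → y , y′ , b′-unique by , b′-unique by′ , adjH)
        (edges (embed s) (embed s′) (embed-sound s) (embed-sound s′) adj) }
    where
    a′≡a′ : ∀ {x x′} → a′ x ≡ a′ x′ → a x ≡ a x′
    a′≡a′ {x} {x′} eq = trans (sym (embed-a′ x)) (trans (cong embed eq) (embed-a′ x′))
    b′≡b′ : ∀ {y y′} → b′ y ≡ b′ y′ → b y ≡ b y′
    b′≡b′ {y} {y′} eq = trans (sym (embed-b′ y)) (trans (cong embed eq) (embed-b′ y′))
    b′-from-b : ∀ {x y} → a x ≡ b y → a′ x ≡ b′ y
    b′-from-b {y = y} eq = a′-unique (trans eq (sym (embed-b′ y)))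

record EdgeGluing (A B : Graph) (eA : Edge A) (eB : Edge B) : Set where
  field
    K : Graph
    inl : V A → V K
    inr : V B → V K
    isGluing : IsGluing A B (single eA) (single eB) K inl inr
    glued-src : inl (src eA) ≡ inr (src eB)
    glued-tgt : inl (tgt eA) ≡ inr (tgt eB)

module EdgeGluingFacts {A B : Graph} {eA : Edge A} {eB : Edge B} (Γ : EdgeGluing A B eA eB) where
  open EdgeGluing Γ
  open IsGluing isGluing

  inl≡inr : ∀ {y u} → inl y ≡ inr u → (y ≡ src eA × u ≡ src eB) ⊎ (y ≡ tgt eA × u ≡ tgt eB)
  inl≡inr {y} {u} eq with only-glue y u eq
  ... | zero , inj₁ refl = inj₁ (refl , iH-inj _ _ (trans (sym eq) glued-src))
  ... | zero , inj₂ refl = inj₂ (refl , iH-inj _ _ (trans (sym eq) glued-tgt))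

  inr-reflects-Adj : ∀ u u′ → Adj K (inr u) (inr u′) → Adj B u u′
  inr-reflects-Adj u u′ adj with edges-K _ _ adj
  ... | inj₂ (v , v′ , eq , eq′ , adjB) = subst₂ (Adj B) (iH-inj _ _ eq) (iH-inj _ _ eq′) adjB
  ... | inj₁ (y , y′ , eq , eq′ , adjA) with Endpoints-adjacent B eB (Sum.map proj₂ proj₂ (inl≡inr eq))
                                                                    (Sum.map proj₂ proj₂ (inl≡inr eq′))
  ...   | inj₂ adjB = adjB
  ...   | inj₁ refl = contradiction (iG-inj _ _ (trans eq (sym eq′))) (Adj⇒≢ A adjA)

  retractʳ : V K → V B
  retractʳ z with image? inr z
  ... | yes (u , _) = u
  ... | no _ = src eB

  retractʳ-inr : ∀ u → retractʳ (inr u) ≡ u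
  retractʳ-inr u with image? inr (inr u)
  ... | yes (u′ , eq) = iH-inj _ _ eq
  ... | no ∉ = contradiction (u , refl) ∉

  retractʳ-inl : ∀ y → Endpoint (retractʳ (inl y)) eB
  retractʳ-inl y with image? inr (inl y)
  ... | yes (u , eq) = Sum.map proj₂ proj₂ (inl≡inr (sym eq))
  ... | no _ = inj₁ refl

  retractʳ-weakHom : WeakHom K B retractʳ
  retractʳ-weakHom z z′ adj with edges-K z z′ adj
  ... | inj₂ (u , u′ , refl , refl , adjB) =
        inj₂ (subst₂ (Adj B) (sym (retractʳ-inr u)) (sym (retractʳ-inr u′)) adjB)
  ... | inj₁ (y , y′ , refl , refl , _) = Endpoints-adjacent B eB (retractʳ-inl y) (retractʳ-inl y′)

EdgeGluing-swap : ∀ {A B eA eB} → EdgeGluing A B eA eB → EdgeGluing B A eB eA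
EdgeGluing-swap Γ = record
  { K = K
  ; inl = inr
  ; inr = inl
  ; isGluing = record
    { iG-inj = iH-inj
    ; iH-inj = iG-inj
    ; cover = λ z → Sum.swap (cover z)
    ; glue = λ { zero → inj₁ (sym glued-src , sym glued-tgt) }
    ; only-glue = λ u y eq → zero , Sum.map proj₂ proj₂ (inl≡inr (sym eq))
    ; edges-G = edges-H
    ; edges-H = edges-G
    ; edges-K = λ z z′ adj → Sum.swap (edges-K z z′ adj) }
  ; glued-src = sym glued-src
  ; glued-tgt = sym glued-tgt }
  where
  open EdgeGluing Γ
  open IsGluing isGluing
  open EdgeGluingFacts Γ using (inl≡inr)

-- The vertices of A fill the first n A slots and those of B the last n B, except that the ends
-- of eA are sent to those of eB; the two slots left empty disappear on passing to the joint image.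
module EdgeGluingConstruction (A B : Graph) (eA : Edge A) (eB : Edge B) where

  β : V B → Fin (n A + n B)
  β u = n A ↑ʳ u

  α : V A → Fin (n A + n B)
  α y with y ≟ src eA | y ≟ tgt eA
  ... | yes _ | _ = β (src eB)
  ... | no _ | yes _ = β (tgt eB)
  ... | no _ | no _ = y ↑ˡ n B

  data αView (y : V A) : Fin (n A + n B) → Set where
    at-src : y ≡ src eA → αView y (β (src eB))
    at-tgt : y ≡ tgt eA → αView y (β (tgt eB))
    inside : ¬ Endpoint y eA → αView y (y ↑ˡ n B)

  α-view : ∀ y → αView y (α y)
  α-view y with y ≟ src eA | y ≟ tgt eA
  ... | yes y≡s | _ = at-src y≡s
  ... | no _ | yes y≡t = at-tgt y≡t
  ... | no y≢s | no y≢t = inside [ y≢s , y≢t ]′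

  ↑ˡ≢↑ʳ : ∀ (y : V A) (u : V B) → y ↑ˡ n B ≢ n A ↑ʳ u
  ↑ˡ≢↑ʳ y u eq
    with trans (sym (splitAt-↑ˡ (n A) y (n B))) (trans (cong (splitAt (n A)) eq) (splitAt-↑ʳ (n A) (n B) u))
  ... | ()

  β-injective : ∀ u u′ → β u ≡ β u′ → u ≡ u′
  β-injective = ↑ʳ-injective (n A)

  α≡β : ∀ {y u} → α y ≡ β u → (y ≡ src eA × u ≡ src eB) ⊎ (y ≡ tgt eA × u ≡ tgt eB)
  α≡β {y} eq with α y | α-view y
  ... | _ | at-src y≡s = inj₁ (y≡s , sym (β-injective _ _ eq))
  ... | _ | at-tgt y≡t = inj₂ (y≡t , sym (β-injective _ _ eq))
  ... | _ | inside _ = contradiction eq (↑ˡ≢↑ʳ y _)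

  α-injective : ∀ y y′ → α y ≡ α y′ → y ≡ y′
  α-injective y y′ eq with α y′ | α-view y′
  ... | _ | at-src y′≡s with α≡β eq
  ...   | inj₁ (y≡s , _) = trans y≡s (sym y′≡s)
  ...   | inj₂ (_ , s≡t) = contradiction s≡t (src≢tgt eB)
  α-injective y y′ eq | _ | at-tgt y′≡t with α≡β eq
  ...   | inj₁ (_ , t≡s) = contradiction (sym t≡s) (src≢tgt eB)
  ...   | inj₂ (y≡t , _) = trans y≡t (sym y′≡t)
  α-injective y y′ eq | _ | inside _ with α y | α-view y
  ...   | _ | inside _ = ↑ˡ-injective (n B) y y′ eq
  ...   | _ | at-src _ = contradiction (sym eq) (↑ˡ≢↑ʳ y′ _)
  ...   | _ | at-tgt _ = contradiction (sym eq) (↑ˡ≢↑ʳ y′ _)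

  α-src : α (src eA) ≡ β (src eB)
  α-src with α (src eA) | α-view (src eA)
  ... | _ | at-src _ = refl
  ... | _ | at-tgt s≡t = contradiction s≡t (src≢tgt eA)
  ... | _ | inside ∉ = contradiction (inj₁ refl) ∉

  α-tgt : α (tgt eA) ≡ β (tgt eB)
  α-tgt with α (tgt eA) | α-view (tgt eA)
  ... | _ | at-src t≡s = contradiction (sym t≡s) (src≢tgt eA)
  ... | _ | at-tgt _ = refl
  ... | _ | inside ∉ = contradiction (inj₂ refl) ∉

  UnionAdj : Fin (n A + n B) → Fin (n A + n B) → Set
  UnionAdj z z′ = (∃ λ y → ∃ λ y′ → α y ≡ z × α y′ ≡ z′ × Adj A y y′)
                ⊎ (∃ λ u → ∃ λ u′ → β u ≡ z × β u′ ≡ z′ × Adj B u u′)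

  unionAdj? : ∀ z z′ → Dec (UnionAdj z z′)
  unionAdj? z z′ =
        any? (λ y → any? (λ y′ → (α y ≟ z) ×-dec (α y′ ≟ z′) ×-dec T? (adj A y y′)))
    ⊎-dec any? (λ u → any? (λ u′ → (β u ≟ z) ×-dec (β u′ ≟ z′) ×-dec T? (adj B u u′)))

  UnionAdj-sym : ∀ {z z′} → UnionAdj z z′ → UnionAdj z′ z
  UnionAdj-sym (inj₁ (y , y′ , eq , eq′ , adj)) = inj₁ (y′ , y , eq′ , eq , Adj-sym A adj)
  UnionAdj-sym (inj₂ (u , u′ , eq , eq′ , adj)) = inj₂ (u′ , u , eq′ , eq , Adj-sym B adj)

  UnionAdj-irrefl : ∀ z → ¬ UnionAdj z z
  UnionAdj-irrefl z (inj₁ (y , y′ , eq , eq′ , adj)) = Adj⇒≢ A adj (α-injective _ _ (trans eq (sym eq′)))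
  UnionAdj-irrefl z (inj₂ (u , u′ , eq , eq′ , adj)) = Adj⇒≢ B adj (β-injective _ _ (trans eq (sym eq′)))

  unionAdj-sym : ∀ z z′ → ⌊ unionAdj? z z′ ⌋ ≡ ⌊ unionAdj? z′ z ⌋
  unionAdj-sym z z′ with unionAdj? z z′ | unionAdj? z′ z
  ... | yes _ | yes _ = refl
  ... | no _ | no _ = refl
  ... | yes adj | no ¬adj = contradiction (UnionAdj-sym adj) ¬adj
  ... | no ¬adj | yes adj = contradiction (UnionAdj-sym adj) ¬adj

  unionAdj-irrefl : ∀ z → ⌊ unionAdj? z z ⌋ ≡ false
  unionAdj-irrefl z with unionAdj? z z
  ... | yes adj = contradiction adj (UnionAdj-irrefl z)
  ... | no _ = refl

  U : Graph
  U = record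
    { n = n A + n B
    ; adj = λ z z′ → ⌊ unionAdj? z z′ ⌋
    ; sym = unionAdj-sym
    ; irrefl = unionAdj-irrefl }

  open JointImage U {A} {B} α β

  edgeGluing : EdgeGluing A B eA eB
  edgeGluing = record
    { K = S
    ; inl = a′
    ; inr = b′
    ; isGluing = isGluing α-injective β-injective
        (λ { zero → inj₁ (α-src , α-tgt) })
        (λ y u eq → zero , Sum.map proj₁ proj₁ (α≡β eq))
        (λ y y′ adj → fromWitness (inj₁ (y , y′ , refl , refl , adj)))
        (λ u u′ adj → fromWitness (inj₂ (u , u′ , refl , refl , adj)))
        (λ z z′ _ _ adj → toWitness adj)
    ; glued-src = a′-unique (trans α-src (sym (embed-b′ _)))
    ; glued-tgt = a′-unique (trans α-tgt (sym (embed-b′ _))) }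

opaque
  glueAlongEdge : (A B : Graph) (eA : Edge A) (eB : Edge B) → EdgeGluing A B eA eB
  glueAlongEdge = EdgeGluingConstruction.edgeGluing

-- Attaching a determiner to a coloured edge

module Overlay {r : ℕ} {A K : Graph} (h : V A → V K) (h-injective : ∀ x y → h x ≡ h y → x ≡ y) where

  ImageEdge : V K → V K → Set
  ImageEdge p q = ∃ λ y → ∃ λ y′ → h y ≡ p × h y′ ≡ q × Adj A y y′

  imageEdge? : ∀ p q → Dec (ImageEdge p q)
  imageEdge? p q = any? (λ y → any? (λ y′ → (h y ≟ p) ×-dec (h y′ ≟ q) ×-dec T? (adj A y y′)))

  overlay : PColoring r A → (V K → V K → Maybe (Fin r)) → V K → V K → Maybe (Fin r)
  overlay ξ base p q with imageEdge? p q
  ... | yes (y , y′ , _) = pcol ξ y y′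
  ... | no _ = base p q

  overlay-image : ∀ ξ base {y y′} → Adj A y y′ → overlay ξ base (h y) (h y′) ≡ pcol ξ y y′
  overlay-image ξ base {y} {y′} adj with imageEdge? (h y) (h y′)
  ... | yes (x , x′ , hx≡hy , hx′≡hy′ , _) rewrite h-injective _ _ hx≡hy | h-injective _ _ hx′≡hy′ = refl
  ... | no ¬image = contradiction (y , y′ , refl , refl , adj) ¬image

  overlay-outside : ∀ ξ base {p q} → ¬ ImageEdge p q → overlay ξ base p q ≡ base p q
  overlay-outside ξ base {p} {q} ¬image with imageEdge? p q
  ... | yes image = contradiction image ¬image
  ... | no _ = refl

  overlay-sym : ∀ ξ base → (∀ p q → Adj K p q → base p q ≡ base q p) →
    ∀ p q → Adj K p q → overlay ξ base p q ≡ overlay ξ base q p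
  overlay-sym ξ base base-sym p q adj with imageEdge? p q
  ... | yes (y , y′ , refl , refl , adjA) =
        trans (pcol-sym ξ y y′ adjA) (sym (overlay-image ξ base (Adj-sym A adjA)))
  ... | no ¬image = trans (base-sym p q adj) (sym (overlay-outside ξ base ¬image′))
    where
    ¬image′ : ¬ ImageEdge q p
    ¬image′ (y , y′ , hy , hy′ , adjA) = ¬image (y′ , y , hy′ , hy , Adj-sym A adjA)

  overlay-coloured : ∀ ξ base {p q c} → overlay ξ base p q ≡ just c →
      (∃ λ y → ∃ λ y′ → h y ≡ p × h y′ ≡ q × Adj A y y′ × pcol ξ y y′ ≡ just c)
    ⊎ (¬ ImageEdge p q × base p q ≡ just c)
  overlay-coloured ξ base {p} {q} eq with imageEdge? p q
  ... | yes (y , y′ , hy , hy′ , adjA) = inj₁ (y , y′ , hy , hy′ , adjA , eq)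
  ... | no ¬image = inj₂ (¬image , eq)

Coloured : ∀ {r} {G : Graph} → PColoring r G → V G → V G → Set
Coloured {G = G} ξ p q = Adj G p q × ∃ λ c → pcol ξ p q ≡ just c

Coloured-sym : ∀ {r} {G : Graph} (ξ : PColoring r G) {p q} → Coloured ξ p q → Coloured ξ q p
Coloured-sym {G = G} ξ (adj , c , eq) = Adj-sym G adj , c , trans (pcol-flip ξ adj) eq

just? : ∀ {A : Set} (m : Maybe A) → Dec (∃ λ a → m ≡ just a)
just? nothing = no λ ()
just? (just a) = yes (a , refl)

coloured? : ∀ {r} {G : Graph} (ξ : PColoring r G) p q → Dec (Coloured ξ p q)
coloured? {G = G} ξ p q = T? (adj G p q) ×-dec just? (pcol ξ p q)

Far : (G : Graph) → Edge G → ℕ → V G → Set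
Far G e d p = ∀ w → Endpoint w e → ∀ ℓ → Walk G w p ℓ → d ≤ ℓ

FarEdge : (G : Graph) → Edge G → ℕ → V G → V G → Set
FarEdge G e d p q = Far G e d p × Far G e d q

Far-one : ∀ {G e p} → ¬ Endpoint p e → Far G e 1 p
Far-one p∉e w w-end .0 here = contradiction w-end p∉e
Far-one p∉e w w-end _ (step _ _) = s≤s z≤n

Far-one⁻¹ : ∀ {G e p} → Far G e 1 p → ¬ Endpoint p e
Far-one⁻¹ far p-end with far _ p-end 0 here
... | ()

GluedExtension : ∀ {r} → Family r → {G H : Graph} → PColoring r G → Coloring r H →
  (K : Graph) → (V G → V K) → (V H → V K) → Set
GluedExtension {r} 𝓕 {G} {H} ξ γH K iG iH = ∃ λ (γK : Coloring r K) →
    (∀ x x′ → Adj G x x′ → ∀ c → pcol ξ x x′ ≡ just c → col γK (iG x) (iG x′) ≡ c)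
  × (∀ y y′ → Adj H y y′ → col γK (iH y) (iH y′) ≡ col γH y y′)
  × Free 𝓕 K γK

record SafeDet {r} (𝓕 : Family r) (i : Fin r) : Set₁ where
  field
    G : Graph
    ξ : PColoring r G
    e : Edge G
    determiner : IsDeterminer 𝓕 i G ξ e
    safe : Safe 𝓕 G ξ (single e)

record Repair {r} {𝓕 : Family r} {i : Fin r} (Δ : SafeDet 𝓕 i) (d : ℕ) (g : Edge (SafeDet.G Δ)) : Set₁ where
  open SafeDet Δ
  field
    next : SafeDet 𝓕 i
    κ : V G → V (SafeDet.G next)
    Far-κ : ∀ {m} x → Far G e m x → Far (SafeDet.G next) (SafeDet.e next) m (κ x)
    coloured-next : ∀ {p q} → Coloured (SafeDet.ξ next) p q →
        FarEdge (SafeDet.G next) (SafeDet.e next) d p q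
      ⊎ (∃ λ x → ∃ λ x′ → κ x ≡ p × κ x′ ≡ q × Coloured ξ x x′ × ¬ Ends g x x′)

Repair-flip : ∀ {r} {𝓕 : Family r} {i} {Δ : SafeDet 𝓕 i} {d} {g : Edge (SafeDet.G Δ)} {adj} →
  Repair Δ d g → Repair Δ d (edge (tgt g) (src g) adj)
Repair-flip R = record
  { next = next
  ; κ = κ
  ; Far-κ = Far-κ
  ; coloured-next = λ coloured → Sum.map₂
      (λ (x , x′ , κx , κx′ , colouredΔ , ¬ends) →
         x , x′ , κx , κx′ , colouredΔ , λ ends → ¬ends (Sum.swap ends))
      (coloured-next coloured) }
  where open Repair R

module Attach {r} {𝓕 : Family r} {i c : Fin r} (Δ : SafeDet 𝓕 i) (g : Edge (SafeDet.G Δ))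
  (g-colour : pcol (SafeDet.ξ Δ) (src g) (tgt g) ≡ just c) (Δᴰ : SafeDet 𝓕 c) where

  open SafeDet Δ
  open SafeDet Δᴰ using () renaming (G to D; ξ to ξD; e to eD; determiner to detD; safe to safeD)

  Γ : EdgeGluing D G eD g
  Γ = glueAlongEdge D G eD g

  open EdgeGluing Γ public using (K; glued-src; glued-tgt) renaming (inl to iD; inr to iG)
  open IsGluing (EdgeGluing.isGluing Γ) public using ()
    renaming (iG-inj to iD-injective; iH-inj to iG-injective; edges-G to iD-hom; edges-H to iG-hom;
              edges-K to K-edges; cover to K-cover)
  open EdgeGluingFacts Γ public

  iD≡iG⇒g-end : ∀ {y u} → iD y ≡ iG u → Endpoint u g
  iD≡iG⇒g-end eq = Sum.map proj₂ proj₂ (inl≡inr eq)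

  module OD = Overlay {r} {D} {K} iD iD-injective
  module OG = Overlay {r} {G} {K} iG iG-injective

  -- ξD takes precedence, so g, now identified with the uncoloured eD, loses its colour.
  ξK : PColoring r K
  ξK = record
    { pcol = OD.overlay ξD (OG.overlay ξ (λ _ _ → nothing))
    ; pcol-sym = OD.overlay-sym ξD _ (OG.overlay-sym ξ _ (λ _ _ _ → refl)) }

  Ends? : ∀ u u′ → Dec (Ends g u u′)
  Ends? u u′ = ((u ≟ src g) ×-dec (u′ ≟ tgt g)) ⊎-dec ((u ≟ tgt g) ×-dec (u′ ≟ src g))

  Ends-colour : ∀ {u u′} → Ends g u u′ → pcol ξ u u′ ≡ just c
  Ends-colour (inj₁ (refl , refl)) = g-colour
  Ends-colour (inj₂ (refl , refl)) = trans (pcol-flip ξ (isAdj g)) g-colour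

  Ends⇒D-edge : ∀ {u u′} → Ends g u u′ → OD.ImageEdge (iG u) (iG u′)
  Ends⇒D-edge (inj₁ (refl , refl)) = src eD , tgt eD , glued-src , glued-tgt , isAdj eD
  Ends⇒D-edge (inj₂ (refl , refl)) = tgt eD , src eD , glued-tgt , glued-src , Adj-sym D (isAdj eD)

  D-edge⇒Ends : ∀ {u u′} → OD.ImageEdge (iG u) (iG u′) → Ends g u u′
  D-edge⇒Ends (y , y′ , eq , eq′ , adj) with inl≡inr eq | inl≡inr eq′
  ... | inj₁ (_ , refl) | inj₂ (_ , refl) = inj₁ (refl , refl)
  ... | inj₂ (_ , refl) | inj₁ (_ , refl) = inj₂ (refl , refl)
  ... | inj₁ (refl , _) | inj₁ (refl , _) = contradiction refl (Adj⇒≢ D adj)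
  ... | inj₂ (refl , _) | inj₂ (refl , _) = contradiction refl (Adj⇒≢ D adj)

  ξK-D : ∀ {y y′} → Adj D y y′ → pcol ξK (iD y) (iD y′) ≡ pcol ξD y y′
  ξK-D = OD.overlay-image ξD _

  ξK-G : ∀ {u u′} → Adj G u u′ → ¬ Ends g u u′ → pcol ξK (iG u) (iG u′) ≡ pcol ξ u u′
  ξK-G adj ¬ends = trans (OD.overlay-outside ξD _ (λ d → ¬ends (D-edge⇒Ends d))) (OG.overlay-image ξ _ adj)

  data ColouredK (p q : V K) (c′ : Fin r) : Set where
    D-coloured : ∀ {y y′} → iD y ≡ p → iD y′ ≡ q → Adj D y y′ → pcol ξD y y′ ≡ just c′ →
                 ColouredK p q c′
    G-coloured : ∀ {u u′} → iG u ≡ p → iG u′ ≡ q → Adj G u u′ → pcol ξ u u′ ≡ just c′ →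
                 ¬ Ends g u u′ →
                 ColouredK p q c′

  ξK-coloured : ∀ {p q c′} → pcol ξK p q ≡ just c′ → ColouredK p q c′
  ξK-coloured eq with OD.overlay-coloured ξD _ eq
  ... | inj₁ (y , y′ , iDy≡p , iDy′≡q , adj , ξ≡c′) = D-coloured iDy≡p iDy′≡q adj ξ≡c′
  ... | inj₂ (¬D-edge , eq′) with OG.overlay-coloured ξ _ eq′
  ...   | inj₁ (u , u′ , refl , refl , adj , ξ≡c′) =
          G-coloured refl refl adj ξ≡c′ (λ ends → ¬D-edge (Ends⇒D-edge ends))
  ...   | inj₂ (_ , ())

  extends-ξK-along : ∀ {L : Graph} (j : V K → V L) (γ : Coloring r L) →
    (∀ y y′ → Adj D y y′ → ∀ c′ → pcol ξD y y′ ≡ just c′ → col γ (j (iD y)) (j (iD y′)) ≡ c′) →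
    (∀ u u′ → Adj G u u′ → ∀ c′ → pcol ξ u u′ ≡ just c′ → col γ (j (iG u)) (j (iG u′)) ≡ c′) →
    ∀ p q → Adj K p q → ∀ c′ → pcol ξK p q ≡ just c′ → col γ (j p) (j q) ≡ c′
  extends-ξK-along j γ on-D on-G p q _ c′ eq with ξK-coloured eq
  ... | D-coloured refl refl adj ξ≡c′ = on-D _ _ adj c′ ξ≡c′
  ... | G-coloured refl refl adj ξ≡c′ _ = on-G _ _ adj c′ ξ≡c′

  _↾D : Coloring r K → Coloring r D
  γ ↾D = pullback D iD iD-hom γ

  _↾G : Coloring r K → Coloring r G
  γ ↾G = pullback G iG iG-hom γ

  pullbackD-freeExt : ∀ {γK} → FreeExt 𝓕 ξK γK → FreeExt 𝓕 ξD (γK ↾D)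
  pullbackD-freeExt {γK} (ext , free) =
    (λ y y′ adj c′ ξ≡c′ → ext _ _ (iD-hom y y′ adj) c′ (trans (ξK-D adj) ξ≡c′)) ,
    Free-pullback D iD iD-hom γK free

  γK-on-Ends : ∀ {γK u u′} → FreeExt 𝓕 ξK γK → Ends g u u′ → col γK (iG u) (iG u′) ≡ c
  γK-on-Ends {γK} fe (inj₁ (refl , refl)) =
    trans (cong₂ (col γK) (sym glued-src) (sym glued-tgt))
          (IsDeterminer.forced detD (γK ↾D) (pullbackD-freeExt {γK} fe))
  γK-on-Ends {γK} fe (inj₂ (refl , refl)) =
    trans (col-sym γK (iG (tgt g)) (iG (src g)) (iG-hom _ _ (Adj-sym G (isAdj g))))
          (γK-on-Ends {γK} fe (inj₁ (refl , refl)))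

  pullbackG-freeExt : ∀ {γK} → FreeExt 𝓕 ξK γK → FreeExt 𝓕 ξ (γK ↾G)
  pullbackG-freeExt {γK} fe@(ext , free) = extends , Free-pullback G iG iG-hom γK free
    where
    extends : Extends ξ (γK ↾G)
    extends u u′ adj c′ ξ≡c′ with Ends? u u′
    ... | yes ends = trans (γK-on-Ends {γK} fe ends) (just-injective (trans (sym (Ends-colour ends)) ξ≡c′))
    ... | no ¬ends = ext _ _ (iG-hom u u′ adj) c′ (trans (ξK-G {u} {u′} adj ¬ends) ξ≡c′)

  eK : Edge K
  eK = edge (iG (src e)) (iG (tgt e)) (iG-hom _ _ (isAdj e))

  uncoloured-stays : ∀ {u u′ c′} → pcol ξ u u′ ≡ nothing → ¬ ColouredK (iG u) (iG u′) c′
  uncoloured-stays unc (D-coloured eq eq′ adj _) =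
    contradiction (trans (sym unc) (Ends-colour (D-edge⇒Ends (_ , _ , eq , eq′ , adj)))) λ ()
  uncoloured-stays unc (G-coloured eq eq′ _ ξ≡c′ _) with iG-injective _ _ eq | iG-injective _ _ eq′
  ... | refl | refl = contradiction (trans (sym unc) ξ≡c′) λ ()

  g-coloured-at : ∀ {w} → Endpoint w g → ∃ λ z → Adj G w z × pcol ξ w z ≡ just c
  g-coloured-at (inj₁ refl) = tgt g , isAdj g , g-colour
  g-coloured-at (inj₂ refl) = src g , Adj-sym G (isAdj g) , Ends-colour (inj₂ (refl , refl))

  free-vertex-stays-free : ∀ {w} → (∀ z → Adj G w z → pcol ξ w z ≡ nothing) →
    ∀ z → Adj K (iG w) z → pcol ξK (iG w) z ≡ nothing
  free-vertex-stays-free {w} w-free z _ = ≢just⇒≡nothing λ c′ eq → excluded (ξK-coloured eq)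
    where
    excluded : ∀ {c′} → ¬ ColouredK (iG w) z c′
    excluded (D-coloured iDy≡iGw _ _ _) with g-coloured-at (iD≡iG⇒g-end iDy≡iGw)
    ... | z′ , adj , ξ≡c = contradiction (trans (sym (w-free z′ adj)) ξ≡c) λ ()
    excluded (G-coloured iGu≡iGw _ adj ξ≡c′ _) with iG-injective _ _ iGu≡iGw
    ... | refl = contradiction (trans (sym (w-free _ adj)) ξ≡c′) λ ()

  free-extension : ∃ λ γK → FreeExt 𝓕 ξK γK
  free-extension with IsDeterminer.has-free-ext determiner | IsDeterminer.has-free-ext detD
  ... | γG , extG , freeG | γD , feD =
    let γK , extD , γK≡γG , freeK = Safe.glue-ext safeD G γG freeG (single g) (single-disjoint g)
                                      (γD , feD , λ _ → trans (extG _ _ (isAdj g) c g-colour)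
                                                              (sym (IsDeterminer.forced detD γD feD)))
                                      K iD iG (EdgeGluing.isGluing Γ)
    in γK ,
       extends-ξK-along (λ p → p) γK extD (λ u u′ adj c′ ξ≡c′ → trans (γK≡γG u u′ adj) (extG u u′ adj c′ ξ≡c′)) ,
       freeK

  isDeterminer : IsDeterminer 𝓕 i K ξK eK
  isDeterminer = record
    { e-uncolored =
        ≢just⇒≡nothing λ c′ eq → uncoloured-stays (IsDeterminer.e-uncolored determiner) (ξK-coloured eq)
    ; free-endpoint =
        let w , w-end , w-free = IsDeterminer.free-endpoint determiner
        in iG w , Sum.map (cong iG) (cong iG) w-end , free-vertex-stays-free w-free
    ; has-free-ext = free-extension
    ; forced = λ γK fe → IsDeterminer.forced determiner (γK ↾G) (pullbackG-freeExt {γK} fe) }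

  -- (D ⊕ G) ⊕ H = K₂ is regrouped as D ⊕ (G ⊕ H): the copy S of G ⊕ H inside K₂ is coloured by the
  -- safety of G, and then K₂ by the safety of D.
  module Extension (H : Graph) (γH : Coloring r H) (H-free : Free 𝓕 H γH)
    (f : Fin 1 → Edge H) (f-disjoint : PairwiseDisjoint f)
    (γ : Coloring r K) (γ-freeExt : FreeExt 𝓕 ξK γ) (γH≡γ : ∀ j → γH ⟦ f j ⟧ ≡ γ ⟦ single eK j ⟧)
    (K₂ : Graph) (jK : V K → V K₂) (jH : V H → V K₂) (K₂-gluing : IsGluing K H (single eK) f K₂ jK jH) where

    open IsGluing K₂-gluing using () renaming
      (iG-inj to jK-injective; iH-inj to jH-injective; cover to K₂-cover; glue to K₂-glue;
       only-glue to K₂-only-glue; edges-G to jK-hom; edges-H to jH-hom; edges-K to K₂-edges)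
    open JointImage K₂ {G} {H} (λ u → jK (iG u)) jH

    eK-end⇒Image : ∀ {k} → Endpoint k eK → Image iG k
    eK-end⇒Image (inj₁ refl) = src e , refl
    eK-end⇒Image (inj₂ refl) = tgt e , refl

    from-G-part : ∀ {k z} → jK k ≡ z → InImage z → Image iG k
    from-G-part jKk≡z (inj₁ (u , jKiGu≡z)) = u , jK-injective _ _ (trans jKiGu≡z (sym jKk≡z))
    from-G-part jKk≡z (inj₂ (y , jHy≡z)) = eK-end⇒Image (proj₂ (K₂-only-glue _ y (trans jKk≡z (sym jHy≡z))))

    G⊕H-gluing : IsGluing G H (single e) f S a′ b′
    G⊕H-gluing = isGluing
      (λ u u′ eq → iG-injective _ _ (jK-injective _ _ eq))
      jH-injective
      K₂-glue
      (λ u y eq → zero , Sum.map (iG-injective _ _) (iG-injective _ _) (proj₂ (K₂-only-glue (iG u) y eq)))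
      (λ u u′ adj → jK-hom _ _ (iG-hom u u′ adj))
      jH-hom
      edges
      where
      edges : ∀ z z′ → InImage z → InImage z′ → Adj K₂ z z′ →
          (∃ λ u → ∃ λ u′ → jK (iG u) ≡ z × jK (iG u′) ≡ z′ × Adj G u u′)
        ⊎ (∃ λ y → ∃ λ y′ → jH y ≡ z × jH y′ ≡ z′ × Adj H y y′)
      edges z z′ z∈ z′∈ adj with K₂-edges z z′ adj
      ... | inj₂ H-edge = inj₂ H-edge
      ... | inj₁ (k , k′ , jKk≡z , jKk′≡z′ , adjK) with from-G-part jKk≡z z∈ | from-G-part jKk′≡z′ z′∈
      ...   | u , refl | u′ , refl = inj₁ (u , u′ , jKk≡z , jKk′≡z′ , inr-reflects-Adj u u′ adjK)

    open IsGluing G⊕H-gluing using () renaming (edges-G to a′-hom; edges-H to b′-hom)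

    γS-spec : GluedExtension 𝓕 ξ γH S a′ b′
    γS-spec = Safe.glue-ext safe H γH H-free f f-disjoint (γ ↾G , pullbackG-freeExt {γ} γ-freeExt , γH≡γ)
                            S a′ b′ G⊕H-gluing

    γS : Coloring r S
    γS = proj₁ γS-spec

    γS-extends : ∀ u u′ → Adj G u u′ → ∀ c′ → pcol ξ u u′ ≡ just c′ → col γS (a′ u) (a′ u′) ≡ c′
    γS-extends = proj₁ (proj₂ γS-spec)

    γS-on-H : ∀ y y′ → Adj H y y′ → col γS (b′ y) (b′ y′) ≡ col γH y y′
    γS-on-H = proj₁ (proj₂ (proj₂ γS-spec))

    γS-free : Free 𝓕 S γS
    γS-free = proj₂ (proj₂ (proj₂ γS-spec))

    gS : Edge S
    gS = edge (a′ (src g)) (a′ (tgt g)) (a′-hom _ _ (isAdj g))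

    D⊕S-gluing : IsGluing D S (single eD) (single gS) K₂ (λ y → jK (iD y)) embed
    D⊕S-gluing = record
      { iG-inj = λ y y′ eq → iD-injective _ _ (jK-injective _ _ eq)
      ; iH-inj = embed-injective
      ; cover = cover′
      ; glue = λ _ → inj₁ (trans (cong jK glued-src) (sym (embed-a′ (src g))) ,
                           trans (cong jK glued-tgt) (sym (embed-a′ (tgt g))))
      ; only-glue = λ y s eq → zero ,
          Sum.map proj₁ proj₁ (inl≡inr (sym (proj₂ (from-G-part eq (embed-sound s)))))
      ; edges-G = λ y y′ adj → jK-hom _ _ (iD-hom y y′ adj)
      ; edges-H = λ _ _ adj → adj
      ; edges-K = edges }
      where
      cover′ : ∀ z → Image (λ y → jK (iD y)) z ⊎ Image embed z
      cover′ z with inImage? z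
      ... | yes z∈ = inj₂ (embed-complete z z∈)
      ... | no z∉ with K₂-cover z
      ...   | inj₂ (y , jHy≡z) = contradiction (inj₂ (y , jHy≡z)) z∉
      ...   | inj₁ (k , jKk≡z) with K-cover k
      ...     | inj₁ (y , iDy≡k) = inj₁ (y , trans (cong jK iDy≡k) jKk≡z)
      ...     | inj₂ (u , iGu≡k) = contradiction (inj₁ (u , trans (cong jK iGu≡k) jKk≡z)) z∉
      edges : ∀ z z′ → Adj K₂ z z′ →
          (∃ λ y → ∃ λ y′ → jK (iD y) ≡ z × jK (iD y′) ≡ z′ × Adj D y y′)
        ⊎ (∃ λ t → ∃ λ t′ → embed t ≡ z × embed t′ ≡ z′ × Adj S t t′)
      edges z z′ adj with K₂-edges z z′ adj
      ... | inj₂ (y , y′ , jHy≡z , jHy′≡z′ , adjH) =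
            inj₂ (b′ y , b′ y′ , trans (embed-b′ y) jHy≡z , trans (embed-b′ y′) jHy′≡z′ , b′-hom y y′ adjH)
      ... | inj₁ (k , k′ , jKk≡z , jKk′≡z′ , adjK) with K-edges k k′ adjK
      ...   | inj₁ (y , y′ , refl , refl , adjD) = inj₁ (y , y′ , jKk≡z , jKk′≡z′ , adjD)
      ...   | inj₂ (u , u′ , refl , refl , adjG) =
              inj₂ (a′ u , a′ u′ , trans (embed-a′ u) jKk≡z , trans (embed-a′ u′) jKk′≡z′ , a′-hom u u′ adjG)

    γK₂-spec : GluedExtension 𝓕 ξD γS K₂ (λ y → jK (iD y)) embed
    γK₂-spec with IsDeterminer.has-free-ext detD
    ... | γD , feD = Safe.glue-ext safeD S γS γS-free (single gS) (single-disjoint gS)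
          (γD , feD , λ _ → trans (γS-extends _ _ (isAdj g) c g-colour) (sym (IsDeterminer.forced detD γD feD)))
          K₂ (λ y → jK (iD y)) embed D⊕S-gluing

    extension : GluedExtension 𝓕 ξK γH K₂ jK jH
    extension with γK₂-spec
    ... | γK₂ , extD , γK₂≡γS , free = γK₂ , extends-ξK-along jK γK₂ extD on-G , on-H , free
      where
      on-G : ∀ u u′ → Adj G u u′ → ∀ c′ → pcol ξ u u′ ≡ just c′ → col γK₂ (jK (iG u)) (jK (iG u′)) ≡ c′
      on-G u u′ adj c′ coloured = trans (cong₂ (col γK₂) (sym (embed-a′ u)) (sym (embed-a′ u′)))
                                        (trans (γK₂≡γS _ _ (a′-hom u u′ adj)) (γS-extends u u′ adj c′ coloured))
      on-H : ∀ y y′ → Adj H y y′ → col γK₂ (jH y) (jH y′) ≡ col γH y y′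
      on-H y y′ adj = trans (cong₂ (col γK₂) (sym (embed-b′ y)) (sym (embed-b′ y′)))
                            (trans (γK₂≡γS _ _ (b′-hom y y′ adj)) (γS-on-H y y′ adj))

  isSafe : Safe 𝓕 K ξK (single eK)
  isSafe = record
    { disjoint = single-disjoint eK
    ; uncolored = λ _ → IsDeterminer.e-uncolored isDeterminer
    ; has-free-ext = free-extension
    ; glue-ext = λ H γH H-free f f-disjoint (γ , γ-freeExt , γH≡γ) K₂ jK jH K₂-gluing →
        Extension.extension H γH H-free f f-disjoint γ γ-freeExt γH≡γ K₂ jK jH K₂-gluing }

  attached : SafeDet 𝓕 i
  attached = record { G = K ; ξ = ξK ; e = eK ; determiner = isDeterminer ; safe = isSafe }

  eK-end : ∀ {w} → Endpoint w eK → ∃ λ w₀ → Endpoint w₀ e × iG w₀ ≡ w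
  eK-end (inj₁ refl) = src e , inj₁ refl , refl
  eK-end (inj₂ refl) = tgt e , inj₂ refl , refl

  Far-iG : ∀ {d u} → Far G e d u → Far K eK d (iG u)
  Far-iG {u = u} far w w-end ℓ walk with eK-end w-end
  ... | w₀ , w₀-end , refl with WeakHom-Walk retractʳ-weakHom walk
  ...   | ℓ′ , ℓ′≤ℓ , walk′ =
          ≤-trans (far w₀ w₀-end ℓ′ (subst₂ (λ a b → Walk G a b ℓ′) (retractʳ-inr w₀) (retractʳ-inr u) walk′))
                  ℓ′≤ℓ

  repair : ∀ {d} → (∀ {y y′} → Coloured ξD y y′ → Far K eK d (iD y)) → Repair Δ d g
  repair {d} far-D = record
    { next = attached
    ; κ = iG
    ; Far-κ = λ _ → Far-iG
    ; coloured-next = λ (_ , c′ , eq) → classify (ξK-coloured eq) }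
    where
    classify : ∀ {p q c′} → ColouredK p q c′ →
        FarEdge K eK d p q ⊎ (∃ λ x → ∃ λ x′ → iG x ≡ p × iG x′ ≡ q × Coloured ξ x x′ × ¬ Ends g x x′)
    classify (D-coloured refl refl adj coloured) =
      inj₁ (far-D (adj , _ , coloured) , far-D (Coloured-sym ξD (adj , _ , coloured)))
    classify (G-coloured refl refl adj coloured ¬ends) = inj₂ (_ , _ , refl , refl , (adj , _ , coloured) , ¬ends)

  FreeIn : V D → Set
  FreeIn y = ∀ z → Adj D y z → pcol ξD y z ≡ nothing

  coloured-not-free : ∀ {y y′} → Coloured ξD y y′ → ¬ FreeIn y
  coloured-not-free (adj , _ , coloured) free = contradiction (trans (sym (free _ adj)) coloured) λ ()

  Far-one-iD : FreeIn (src eD) ⊎ ¬ Endpoint (src g) e → FreeIn (tgt eD) ⊎ ¬ Endpoint (tgt g) e →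
    ∀ {y y′} → Coloured ξD y y′ → Far K eK 1 (iD y)
  Far-one-iD src-ok tgt-ok {y} coloured = Far-one {K} {eK} λ iDy-end → excluded (eK-end iDy-end)
    where
    rule-out : ∀ {y₀ u} → y ≡ y₀ → FreeIn y₀ ⊎ ¬ Endpoint u e → ¬ Endpoint u e
    rule-out refl (inj₁ free) = contradiction free (coloured-not-free coloured)
    rule-out refl (inj₂ u∉e) = u∉e
    excluded : ¬ (∃ λ w₀ → Endpoint w₀ e × iG w₀ ≡ iD y)
    excluded (w₀ , w₀-end , iGw₀≡iDy) with inl≡inr (sym iGw₀≡iDy)
    ... | inj₁ (y≡s , refl) = rule-out y≡s src-ok w₀-end
    ... | inj₂ (y≡t , refl) = rule-out y≡t tgt-ok w₀-end

  open EdgeGluingFacts (EdgeGluing-swap Γ) using () renaming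
    ( retractʳ to retractᴰ; retractʳ-inr to retractᴰ-iD; retractʳ-inl to retractᴰ-iG
    ; retractʳ-weakHom to retractᴰ-weakHom)

  -- A walk from e starts with an edge of G, as the ends of g are not on e, and the rest of it
  -- retracts onto a walk in D from an end of eD.
  Far-suc-iD : ∀ {d y} → Far G e 1 (src g) → Far G e 1 (tgt g) → Far D eD d y → Far K eK (suc d) (iD y)
  Far-suc-iD {d} {y} src-far tgt-far far w w-end ℓ walk with eK-end w-end
  ... | w₀ , w₀-end , refl = leaving-G walk refl refl
    where
    not-glued : ∀ {y₁} → iD y₁ ≢ iG w₀
    not-glued eq with iD≡iG⇒g-end eq
    ... | inj₁ refl = Far-one⁻¹ {G} {e} src-far w₀-end
    ... | inj₂ refl = Far-one⁻¹ {G} {e} tgt-far w₀-end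
    leaving-G : ∀ {a b ℓ} → Walk K a b ℓ → a ≡ iG w₀ → b ≡ iD y → suc d ≤ ℓ
    leaving-G here refl b≡iDy = contradiction (sym b≡iDy) not-glued
    leaving-G (step {v = v} adj rest) refl refl with K-edges _ v adj
    ... | inj₁ (_ , _ , iDy₁≡iGw₀ , _ , _) = contradiction iDy₁≡iGw₀ not-glued
    ... | inj₂ (_ , u , _ , refl , _) with WeakHom-Walk retractᴰ-weakHom rest
    ...   | ℓ′ , ℓ′≤ℓ , walkD =
            s≤s (≤-trans (far _ (retractᴰ-iG u) ℓ′ (subst (λ b → Walk D _ b ℓ′) (retractᴰ-iD y) walkD))
                         ℓ′≤ℓ)

allPairs : ∀ n → List (Fin n × Fin n)
allPairs n = cartesianProduct (allFin n) (allFin n)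

-- Pushing the colouring away from e

AllFar : ∀ {r} {𝓕 : Family r} {i} → SafeDet 𝓕 i → ℕ → Set
AllFar Δ d = ∀ p q → Coloured ξ p q → FarEdge G e d p q
  where open SafeDet Δ

AllFar-zero : ∀ {r} {𝓕 : Family r} {i} (Δ : SafeDet 𝓕 i) → AllFar Δ 0
AllFar-zero Δ _ _ _ = (λ _ _ _ _ → z≤n) , (λ _ _ _ _ → z≤n)

module _ {r} {𝓕 : Family r} {i : Fin r} where

  Repairer : ℕ → ℕ → Set₁
  Repairer k d = ∀ (Δ : SafeDet 𝓕 i) {p q} (coloured : Coloured (SafeDet.ξ Δ) p q) →
    FarEdge (SafeDet.G Δ) (SafeDet.e Δ) k p q → Repair Δ d (edge p q (proj₁ coloured))

  module Saturation {k d : ℕ} (repair : Repairer k d) (G₀ : Graph) where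

    -- track follows the vertices of G₀ through the successive gluings, so that the pairs still to be
    -- repaired can be listed in advance.
    record Tracked : Set₁ where
      field
        current : SafeDet 𝓕 i
        track : V G₀ → V (SafeDet.G current)
      open SafeDet current public

    open Tracked

    Pending : (T : Tracked) → List (V G₀ × V G₀) → V (G T) → V (G T) → Set
    Pending T L p q = ∃ λ u → ∃ λ v → (u , v) ∈ L × track T u ≡ p × track T v ≡ q

    Invariant : Tracked → List (V G₀ × V G₀) → Set
    Invariant T L = ∀ p q → Coloured (ξ T) p q →
      FarEdge (G T) (e T) d p q ⊎ (Pending T L p q × FarEdge (G T) (e T) k p q)

    drop-head : ∀ {T u v L} → Invariant T ((u , v) ∷ L) →
      (Coloured (ξ T) (track T u) (track T v) → FarEdge (G T) (e T) d (track T u) (track T v)) →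
      Invariant T L
    drop-head inv settled p q coloured with inv p q coloured
    ... | inj₁ far = inj₁ far
    ... | inj₂ ((_ , _ , here refl , refl , refl) , _) = inj₁ (settled coloured)
    ... | inj₂ ((u , v , there uv∈L , eq , eq′) , far) = inj₂ ((u , v , uv∈L , eq , eq′) , far)

    advance : (T : Tracked) {g : Edge (G T)} → Repair (current T) d g → Tracked
    advance T R = record { current = Repair.next R ; track = λ u → Repair.κ R (track T u) }

    advance-invariant : ∀ T {u v L} (coloured : Coloured (ξ T) (track T u) (track T v)) →
      Invariant T ((u , v) ∷ L) → (R : Repair (current T) d (edge _ _ (proj₁ coloured))) →
      Invariant (advance T R) L
    advance-invariant T _ inv R p q coloured with Repair.coloured-next R coloured
    ... | inj₁ far = inj₁ far
    ... | inj₂ (x , x′ , refl , refl , colouredT , ¬ends) with inv x x′ colouredT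
    ...   | inj₁ (far , far′) = inj₁ (Repair.Far-κ R x far , Repair.Far-κ R x′ far′)
    ...   | inj₂ ((_ , _ , here refl , refl , refl) , _) = contradiction (inj₁ (refl , refl)) ¬ends
    ...   | inj₂ ((u , v , there uv∈L , refl , refl) , far , far′) =
            inj₂ ((u , v , uv∈L , refl , refl) , Repair.Far-κ R _ far , Repair.Far-κ R _ far′)

    saturate : ∀ T L → Invariant T L → ∃ λ T′ → Invariant T′ []
    saturate T [] inv = T , inv
    saturate T ((u , v) ∷ L) inv with coloured? (ξ T) (track T u) (track T v)
    ... | no ¬coloured = saturate T L (drop-head {T} {u} {v} {L} inv (λ coloured → contradiction coloured ¬coloured))
    ... | yes coloured with inv _ _ coloured
    ...   | inj₁ far = saturate T L (drop-head {T} {u} {v} {L} inv (λ _ → far))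
    ...   | inj₂ (_ , far) = saturate (advance T R) L (advance-invariant T {u} {v} {L} coloured inv R)
      where R = repair (current T) coloured far

  saturated : ∀ {k d} → Repairer k d → (Δ : SafeDet 𝓕 i) → AllFar Δ k →
    ∃ λ (Δ′ : SafeDet 𝓕 i) → AllFar Δ′ d
  saturated {k} {d} repair Δ far-k with saturate T₀ (allPairs (n G)) inv₀
    where
    open SafeDet Δ
    open Saturation repair G
    T₀ : Tracked
    T₀ = record { current = Δ ; track = λ u → u }
    inv₀ : Invariant T₀ (allPairs (n G))
    inv₀ p q coloured =
      inj₂ ((p , q , ∈-cartesianProduct⁺ (∈-allFin p) (∈-allFin q) , refl , refl) , far-k p q coloured)
  ... | T , inv = Saturation.Tracked.current T , settled
    where
    settled : AllFar (Saturation.Tracked.current T) d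
    settled p q coloured with inv p q coloured
    ... | inj₁ far = far
    ... | inj₂ ((_ , _ , () , _) , _)

  module Avoiding (dets : ∀ c → SafeDet 𝓕 c) (Δ : SafeDet 𝓕 i) where
    open SafeDet Δ

    coloured-not-both-ends : ∀ {p q} → Coloured ξ p q → Endpoint p e → ¬ Endpoint q e
    coloured-not-both-ends (adj , _ , _) (inj₁ refl) (inj₁ refl) = Adj⇒≢ G adj refl
    coloured-not-both-ends (adj , _ , _) (inj₂ refl) (inj₂ refl) = Adj⇒≢ G adj refl
    coloured-not-both-ends (adj , _ , ξ≡c) (inj₁ refl) (inj₂ refl) =
      contradiction (trans (sym (IsDeterminer.e-uncolored determiner)) ξ≡c) λ ()
    coloured-not-both-ends (adj , _ , ξ≡c) (inj₂ refl) (inj₁ refl) =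
      contradiction (trans (sym (IsDeterminer.e-uncolored determiner)) (trans (pcol-flip ξ adj) ξ≡c)) λ ()

    -- The free endpoint of the determined edge of D is glued to X, the end of the coloured edge
    -- that may lie on e.
    attach-avoiding : ∀ {X Y c} (adj : Adj G X Y) → pcol ξ X Y ≡ just c → ¬ Endpoint Y e →
      Repair Δ 1 (edge X Y adj)
    attach-avoiding {X} {Y} {c} adj ξ≡c Y∉e with IsDeterminer.free-endpoint (SafeDet.determiner (dets c))
    ... | _ , inj₁ refl , free = repair (Far-one-iD (inj₁ free) (inj₂ Y∉e))
      where open Attach Δ (edge X Y adj) ξ≡c (dets c)
    ... | _ , inj₂ refl , free = Repair-flip (repair (Far-one-iD (inj₂ Y∉e) (inj₁ free)))
      where open Attach Δ (edge Y X (Adj-sym G adj)) (trans (pcol-flip ξ adj) ξ≡c) (dets c)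

    repair-avoiding : ∀ {p q} (coloured : Coloured ξ p q) → Repair Δ 1 (edge p q (proj₁ coloured))
    repair-avoiding {p} {q} coloured@(adj , c , ξ≡c) with (q ≟ src e) ⊎-dec (q ≟ tgt e)
    ... | no q∉e = attach-avoiding adj ξ≡c q∉e
    ... | yes q∈e = Repair-flip (attach-avoiding (Adj-sym G adj) (trans (pcol-flip ξ adj) ξ≡c)
                                   (λ p∈e → coloured-not-both-ends coloured p∈e q∈e))

  avoiding-repairer : (∀ c → SafeDet 𝓕 c) → Repairer 0 1
  avoiding-repairer dets Δ coloured _ = Avoiding.repair-avoiding dets Δ coloured

  remote-repairer : ∀ {d} → (∀ c → ∃ λ (Δ : SafeDet 𝓕 c) → AllFar Δ d) → Repairer 1 (suc d)
  remote-repairer dets Δ (adj , c , ξ≡c) (far-p , far-q) =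
    repair λ colouredD → Far-suc-iD far-p far-q (proj₁ (proj₂ (dets c) _ _ colouredD))
    where open Attach Δ (edge _ _ adj) ξ≡c (proj₁ (dets c))

toSafeDet : ∀ {r} {𝓕 : Family r} {i} → SafeDeterminer 𝓕 i → SafeDet 𝓕 i
toSafeDet (G , ξ , e , det , safe) = record { G = G ; ξ = ξ ; e = e ; determiner = det ; safe = safe }

AllFar⇒Remote : ∀ {r} {𝓕 : Family r} {i d} (Δ : SafeDet 𝓕 i) → AllFar Δ d →
  Remote d (SafeDet.G Δ) (SafeDet.ξ Δ) (SafeDet.e Δ)
AllFar⇒Remote Δ far w w-end x x′ adj c eq _ (inj₁ refl) ℓ walk = proj₁ (far x x′ (adj , c , eq)) w w-end ℓ walk
AllFar⇒Remote Δ far w w-end x x′ adj c eq _ (inj₂ refl) ℓ walk = proj₂ (far x x′ (adj , c , eq)) w w-end ℓ walk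

module _ {r} {𝓕 : Family r} (dets : ∀ c → SafeDet 𝓕 c) where

  avoiding : ∀ i → ∃ λ (Δ : SafeDet 𝓕 i) → AllFar Δ 1
  avoiding i = saturated (avoiding-repairer dets) (dets i) (AllFar-zero (dets i))

  remote : ∀ d i → ∃ λ (Δ : SafeDet 𝓕 i) → AllFar Δ d
  remote zero i = dets i , AllFar-zero (dets i)
  remote (suc d) i = saturated (remote-repairer (remote d)) (proj₁ (avoiding i)) (proj₂ (avoiding i))

lemma6 : (r : ℕ) (𝓕 : Family r) →
         All (λ F → Connected (graph F)) 𝓕 →
         (∀ (i : Fin r) → SafeDeterminer 𝓕 i) →
         ∀ (d : ℕ) (i : Fin r) → SafeRemoteDeterminer 𝓕 d i
lemma6 r 𝓕 _ dets d i with remote (λ c → toSafeDet (dets c)) d i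
... | Δ , far = G , ξ , e , determiner , AllFar⇒Remote Δ far , safe
  where open SafeDet Δ
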